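{- Let $G$ be a graph of girth $g$ and let $\rho=\lfloor \frac{g+1}{4} \rfloor$. Let $u$ be a vertex of $G$, and suppose two cops are at $u$ while the robber is not in $B(u,2\rho-2)$. Then the two cops can play so that the robber can never enter $B(u,\rho)$ without being captured.
   Context: The girth of $G$ is the length of a shortest cycle. $B(u,i)$ is the set of vertices at distance at most $i$ from $u$. Game of Cops and Robbers: cops and robber alternately move (cops first), each either staying or moving to an adjacent vertex; the robber is captured when a cop occupies his vertex after a cops' move (or the robber moves onto a cop). -}

module Defs where

open import Data.Nat using (ℕ; zero; suc; _+_; _*_; _∸_; _≤_; _<_)
open import Data.Nat.DivMod using (_/_)
open import Data.Fin using (Fin; zero; suc; toℕ; fromℕ; inject₁; fromℕ<)
open import Data.Fin.Properties using ()
open import Data.Product using (Σ; ∃; _×_; _,_; proj₁; proj₂)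
open import Data.Sum using (_⊎_)
open import Relation.Nullary using (¬_; Dec)
open import Relation.Binary.PropositionalEquality using (_≡_)
open import Function.Definitions using (Injective)

record Graph : Set₁ where
  field
    n       : ℕ
    Adj     : Fin n → Fin n → Set
    adj-sym : ∀ {x y} → Adj x y → Adj y x
    adj-irr : ∀ {x} → ¬ Adj x x
    adj-dec : ∀ x y → Dec (Adj x y)

open Graph public

V : Graph → Set
V G = Fin (n G)

record Cycle (G : Graph) (k : ℕ) : Set where
  field
    m      : ℕ
    len    : k ≡ suc m
    three  : 3 ≤ k
    vtx    : Fin (suc m) → V G
    inj    : Injective _≡_ _≡_ vtx
    step   : ∀ (i : Fin m) → Adj G (vtx (inject₁ i)) (vtx (suc i))
    close  : Adj G (vtx (fromℕ m)) (vtx zero)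

Girth : Graph → ℕ → Set
Girth G g = Cycle G g × (∀ k → Cycle G k → g ≤ k)

data Walk (G : Graph) : V G → V G → ℕ → Set where
  [] : ∀ {x} → Walk G x x 0
  _∷_ : ∀ {x y z k} → Adj G x y → Walk G y z k → Walk G x z (suc k)

Ball : (G : Graph) → V G → ℕ → V G → Set
Ball G u i v = Σ ℕ λ k → k ≤ i × Walk G u v k

Step : (G : Graph) → V G → V G → Set
Step G x y = x ≡ y ⊎ Adj G x y

-- A (deterministic) strategy for two cops: in round t, knowing the robber's
-- positions r 0, …, r t (and hence, inductively, their own positions),
-- the cops choose their new positions.
CopStrategy : Graph → Set
CopStrategy G = (t : ℕ) → (Fin (suc t) → V G) → V G × V G

-- Positions of the two cops at the start of round t (before the cops' move
-- of round t), when both start at u, against the robber sequence r.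
copPos : (G : Graph) → V G → CopStrategy G → (ℕ → V G) → ℕ → V G × V G
copPos G u σ r zero    = u , u
copPos G u σ r (suc t) = σ t (λ i → r (toℕ i))

CopAt : (G : Graph) → V G × V G → V G → Set
CopAt G p x = proj₁ p ≡ x ⊎ proj₂ p ≡ x

-- Round s: cops move from copPos s to copPos (s+1) while the robber is at r s,
-- then the robber moves from r s to r (s+1).  The robber is captured by round t
-- if for some s ≤ t a cop shares the robber's vertex r s, either before the
-- cops' move (robber moved onto a cop, or started there) or after it.
CapturedBy : (G : Graph) → V G → CopStrategy G → (ℕ → V G) → ℕ → Set
CapturedBy G u σ r t = Σ ℕ λ s → s ≤ t ×
  (CopAt G (copPos G u σ r s) (r s) ⊎ CopAt G (copPos G u σ r (suc s)) (r s))

module Submission where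

open import Defs
open import Data.Nat using (ℕ; zero; suc; _+_; _*_; _∸_; _≤_; _<_; z≤n; s≤s; s≤s⁻¹; _≟_; _≤?_; _<?_)
open import Data.Nat.Properties
open import Data.Nat.DivMod using (_/_; m≥n⇒m/n>0; m/n*n≤m)
open import Data.Fin using (Fin; toℕ; fromℕ; fromℕ<)
open import Data.Fin.Properties using (any?; toℕ-injective; toℕ-inject₁; toℕ-fromℕ; toℕ-fromℕ<; toℕ<n)
  renaming (_≟_ to _≟ᶠ_)
open import Data.Product using (Σ; _×_; _,_; proj₁; proj₂)
open import Data.Sum using (_⊎_; inj₁; inj₂)
open import Data.Empty using (⊥; ⊥-elim)
open import Relation.Nullary using (¬_; Dec; yes; no)
open import Relation.Nullary.Decidable using (_×-dec_; _⊎-dec_)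
open import Relation.Binary.Definitions using (DecidableEquality; tri<; tri≈; tri>)
open import Relation.Binary.PropositionalEquality
open import Data.Nat.Tactic.RingSolver using (solve-∀)

-- Let depth v = min (dist (u, v), K).  As g ≥ 2K − 1, the vertices of depth < K carry a
-- breadth-first tree rooted at u which is forced by the graph: a vertex has a unique
-- neighbour one level down (its parent), and below depth K − 1 no edge joins two vertices
-- of the same depth -- otherwise the two ancestor lines, together with that edge, would
-- close a cycle of length < 2K − 1.  The robber at v casts a shadow onto his own ancestor
-- line: the ancestor S v at depth fold ρ (depth v) (equal to depth v up to ρ, then falling
-- back to 0 as depth v grows to K) together with its parent T v.  Every robber step moves
-- {S v, T v} by at most one step per vertex, so the cops can stay on the shadow; they
-- reach it from u at once since the robber starts at depth K − 1 or K.  A robber that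
-- enters B(u, ρ) must first stand at depth exactly ρ, where S v = v and a cop catches him.

∸-suc : ∀ {m n} → n < m → m ∸ n ≡ suc (m ∸ suc n)
∸-suc n<m = +-∸-assoc 1 n<m

-- 3 + a + b split as (a + 1) + (b + 2), to compare short cycles with 2K.
three-more : ∀ a b → suc (suc (suc (a + b))) ≡ suc a + suc (suc b)
three-more = solve-∀

disagree-extend : ∀ {A : Set} (a b : ℕ → A) {j q} → a (suc q) ≢ b (suc q) →
  (∀ m → j < m → m ≤ q → a m ≢ b m) → ∀ m → j < m → m ≤ suc q → a m ≢ b m
disagree-extend a b {q = q} differ above m j<m m≤ with m ≟ suc q
... | yes refl = differ
... | no m≢ = above m j<m (s≤s⁻¹ (≤∧≢⇒< m≤ m≢))

lastAgreement : ∀ {A : Set} → DecidableEquality A → (a b : ℕ → A) (q : ℕ) →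
  a 0 ≡ b 0 → a q ≢ b q →
  Σ ℕ λ j → j < q × a j ≡ b j × (∀ m → j < m → m ≤ q → a m ≢ b m)
lastAgreement _≟ₐ_ a b zero a0≡b0 a0≢b0 = ⊥-elim (a0≢b0 a0≡b0)
lastAgreement _≟ₐ_ a b (suc q) a0≡b0 differ with a q ≟ₐ b q
... | yes agree = q , ≤-refl , agree ,
  disagree-extend a b differ (λ m q<m m≤q → ⊥-elim (<-irrefl refl (<-≤-trans q<m m≤q)))
... | no disagree with lastAgreement _≟ₐ_ a b q a0≡b0 disagree
...   | j , j<q , agree , above = j , m≤n⇒m≤1+n j<q , agree , disagree-extend a b differ above

hitsLevel : (h : ℕ → ℕ) (ρ : ℕ) → (∀ t → h t ≤ suc (h (suc t))) → ρ ≤ h 0 →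
  ∀ t → h t ≤ ρ → Σ ℕ λ s → s ≤ t × h s ≡ ρ
hitsLevel h ρ slow start zero h0≤ρ = 0 , z≤n , ≤-antisym h0≤ρ start
hitsLevel h ρ slow start (suc t) ht≤ρ with h t ≤? ρ
... | yes earlier with hitsLevel h ρ slow start t earlier
...   | s , s≤t , hit = s , m≤n⇒m≤1+n s≤t , hit
hitsLevel h ρ slow start (suc t) ht≤ρ | no above =
  suc t , ≤-refl , ≤-antisym ht≤ρ (s≤s⁻¹ (≤-trans (≰⇒> above) (slow t)))

snoc : ∀ {G x y z k} → Walk G x y k → Adj G y z → Walk G x z (suc k)
snoc [] a = a ∷ []
snoc (b ∷ w) a = b ∷ snoc w a

unsnoc : ∀ {G x z k} → Walk G x z (suc k) → Σ (V G) λ y → Walk G x y k × Adj G y z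
unsnoc (a ∷ []) = _ , [] , a
unsnoc (a ∷ (b ∷ w)) with unsnoc (b ∷ w)
... | y , w' , c = y , a ∷ w' , c

Step-sym : ∀ {G x y} → Step G x y → Step G y x
Step-sym (inj₁ x≡y) = inj₁ (sym x≡y)
Step-sym {G} (inj₂ xy) = inj₂ (adj-sym G xy)

Step? : (G : Graph) → ∀ x y → Dec (Step G x y)
Step? G x y = (x ≟ᶠ y) ⊎-dec adj-dec G x y

closedWalk-cycle : (G : Graph) (L : ℕ) (c : ℕ → V G) → 3 ≤ L →
  (∀ i → suc i < L → Adj G (c i) (c (suc i))) → Adj G (c (L ∸ 1)) (c 0) →
  (∀ i k → i < L → k < L → c i ≡ c k → i ≡ k) → Cycle G L
closedWalk-cycle G (suc m) c three step close distinct = record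
  { m = m ; len = refl ; three = three ; vtx = λ i → c (toℕ i)
  ; inj = λ {i} {k} ci≡ck → toℕ-injective (distinct (toℕ i) (toℕ k) (toℕ<n i) (toℕ<n k) ci≡ck)
  ; step = λ i → subst (λ z → Adj G (c z) (c (suc (toℕ i)))) (sym (toℕ-inject₁ i))
                        (step (toℕ i) (s≤s (toℕ<n i)))
  ; close = subst (λ z → Adj G (c z) (c 0)) (sym (toℕ-fromℕ m)) close }

-- Two walks a 0, …, a e and b 0, …, b e' (e, e' ≥ 1) from a common vertex a 0 = b 0, each
-- climbing one level of a height function h per edge, disjoint above level j = h (a 0) and
-- joined by an edge a e — b e', close the cycle a 0, …, a e, b e', …, b 1 of length e + e' + 1.
-- Distinctness of its vertices is read off from the heights.
twoBranch-cycle : (G : Graph) (h : V G → ℕ) (a b : ℕ → V G) (j e e' : ℕ) →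
  1 ≤ e → 1 ≤ e' → a 0 ≡ b 0 →
  (∀ i → i < e → Adj G (a i) (a (suc i))) →
  (∀ i → i < e' → Adj G (b i) (b (suc i))) →
  Adj G (a e) (b e') →
  (∀ i → i ≤ e → h (a i) ≡ j + i) →
  (∀ i → i ≤ e' → h (b i) ≡ j + i) →
  (∀ i → 1 ≤ i → i ≤ e' → a i ≢ b i) →
  Cycle G (suc (e + e'))
twoBranch-cycle G h a b j e e' 1≤e 1≤e' base climbᵃ climbᵇ top heightᵃ heightᵇ apart =
  closedWalk-cycle G L c (s≤s (+-mono-≤ 1≤e 1≤e')) steps close distinct
  where
  L : ℕ
  L = suc (e + e')

  glue : (i : ℕ) → Dec (i ≤ e) → V G
  glue i (yes _) = a i
  glue i (no _) = b (L ∸ i)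

  c : ℕ → V G
  c i = glue i (i ≤? e)

  c-up : ∀ i → i ≤ e → c i ≡ a i
  c-up i i≤e with i ≤? e
  ... | yes _ = refl
  ... | no i≰e = ⊥-elim (i≰e i≤e)

  c-down : ∀ i → e < i → c i ≡ b (L ∸ i)
  c-down i e<i with i ≤? e
  ... | yes i≤e = ⊥-elim (<-irrefl refl (<-≤-trans e<i i≤e))
  ... | no _ = refl

  down-index : ∀ k → e < k → k < L → 1 ≤ L ∸ k × L ∸ k ≤ e'
  down-index k e<k k<L = m<n⇒0<n∸m k<L , ≤-trans (∸-monoʳ-≤ L e<k) (≤-reflexive (m+n∸m≡n e e'))

  cross : Adj G (c e) (c (suc e))
  cross = subst₂ (Adj G) (sym (c-up e ≤-refl))
            (sym (trans (c-down (suc e) ≤-refl) (cong b (m+n∸m≡n e e')))) top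

  steps : ∀ i → suc i < L → Adj G (c i) (c (suc i))
  steps i si<L = by-cases (suc i ≤? e) (i ≤? e)
    where
    by-cases : Dec (suc i ≤ e) → Dec (i ≤ e) → Adj G (c i) (c (suc i))
    by-cases (yes si≤e) _ =
      subst₂ (Adj G) (sym (c-up i (≤-trans (n≤1+n i) si≤e))) (sym (c-up (suc i) si≤e)) (climbᵃ i si≤e)
    by-cases (no si≰e) (yes i≤e) =
      subst (λ k → Adj G (c k) (c (suc k))) (sym (≤-antisym i≤e (s≤s⁻¹ (≰⇒> si≰e)))) cross
    by-cases (no _) (no i≰e) =
        subst₂ (Adj G) (sym (c-down i (≰⇒> i≰e))) (sym (c-down (suc i) (m≤n⇒m≤1+n (≰⇒> i≰e))))
          (subst (λ k → Adj G (b k) (b (L ∸ suc i))) (sym (∸-suc (<-trans (n<1+n i) si<L)))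
          (adj-sym G (climbᵇ (L ∸ suc i) below)))
      where
      below : L ∸ suc i < e'
      below = ≤-trans (∸-monoʳ-< (≰⇒> i≰e) (s≤s⁻¹ (<⇒≤ si<L))) (≤-reflexive (m+n∸m≡n e e'))

  close : Adj G (c (L ∸ 1)) (c 0)
  close = subst₂ (Adj G)
            (sym (trans (c-down (e + e') (m<m+n e 1≤e')) (cong b (m+n∸n≡m 1 (e + e')))))
            (sym (trans (c-up 0 z≤n) base))
            (adj-sym G (climbᵇ 0 1≤e'))

  height-up : ∀ i → i ≤ e → h (c i) ≡ j + i
  height-up i i≤e = trans (cong h (c-up i i≤e)) (heightᵃ i i≤e)

  height-down : ∀ i → e < i → i < L → h (c i) ≡ j + (L ∸ i)
  height-down i e<i i<L = trans (cong h (c-down i e<i)) (heightᵇ (L ∸ i) (proj₂ (down-index i e<i i<L)))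

  -- An up-position and a down-position at equal height carry a i and b i with 1 ≤ i ≤ e'.
  no-crossing : ∀ i k → i ≤ e → e < k → k < L → c i ≢ c k
  no-crossing i k i≤e e<k k<L ci≡ck =
    apart i (subst (1 ≤_) (sym i≡) (proj₁ (down-index k e<k k<L)))
            (subst (_≤ e') (sym i≡) (proj₂ (down-index k e<k k<L)))
            (trans (sym (c-up i i≤e)) (trans ci≡ck (trans (c-down k e<k) (cong b (sym i≡)))))
    where
    i≡ : i ≡ L ∸ k
    i≡ = +-cancelˡ-≡ j i (L ∸ k) (trans (sym (height-up i i≤e)) (trans (cong h ci≡ck) (height-down k e<k k<L)))

  distinct : ∀ i k → i < L → k < L → c i ≡ c k → i ≡ k
  distinct i k i<L k<L ci≡ck = by-cases (i ≤? e) (k ≤? e)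
    where
    by-cases : Dec (i ≤ e) → Dec (k ≤ e) → i ≡ k
    by-cases (yes i≤e) (yes k≤e) =
      +-cancelˡ-≡ j i k (trans (sym (height-up i i≤e)) (trans (cong h ci≡ck) (height-up k k≤e)))
    by-cases (yes i≤e) (no k≰e) = ⊥-elim (no-crossing i k i≤e (≰⇒> k≰e) k<L ci≡ck)
    by-cases (no i≰e) (yes k≤e) = ⊥-elim (no-crossing k i k≤e (≰⇒> i≰e) i<L (sym ci≡ck))
    by-cases (no i≰e) (no k≰e) = ∸-cancelˡ-≡ (<⇒≤ i<L) (<⇒≤ k<L)
      (+-cancelˡ-≡ j _ _ (trans (sym (height-down i (≰⇒> i≰e) i<L))
                                (trans (cong h ci≡ck) (height-down k (≰⇒> k≰e) k<L))))

module Depth (G : Graph) (u : V G) (K : ℕ) where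

  walk? : ∀ k v → Dec (Walk G u v k)
  walk? zero v with u ≟ᶠ v
  ... | yes refl = yes []
  ... | no u≢v = no λ { [] → u≢v refl }
  walk? (suc k) v with any? (λ w → walk? k w ×-dec adj-dec G w v)
  ... | yes (w , p , wv) = yes (snoc p wv)
  ... | no none = no λ p → none (proj₁ (unsnoc p) , proj₂ (unsnoc p))

  -- search m i v: the least k with i ≤ k < i + m such that a walk of length k joins u to v,
  -- or i + m if there is none.
  search : ℕ → ℕ → V G → ℕ
  search zero i v = i
  search (suc m) i v with walk? i v
  ... | yes _ = i
  ... | no _ = search m (suc i) v

  search-≤ : ∀ m i v → search m i v ≤ i + m
  search-≤ zero i v = ≤-reflexive (sym (+-identityʳ i))
  search-≤ (suc m) i v with walk? i v
  ... | yes _ = m≤m+n i (suc m)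
  ... | no _ = ≤-trans (search-≤ m (suc i) v) (≤-reflexive (sym (+-suc i m)))

  search-found : ∀ m i v → Walk G u v (search m i v) ⊎ search m i v ≡ i + m
  search-found zero i v = inj₂ (sym (+-identityʳ i))
  search-found (suc m) i v with walk? i v
  ... | yes w = inj₁ w
  ... | no _ with search-found m (suc i) v
  ...   | inj₁ w = inj₁ w
  ...   | inj₂ e = inj₂ (trans e (sym (+-suc i m)))

  search-least : ∀ m i v j → i ≤ j → j < search m i v → ¬ Walk G u v j
  search-least zero i v j i≤j j<i = ⊥-elim (<-irrefl refl (<-≤-trans j<i i≤j))
  search-least (suc m) i v j i≤j j< with walk? i v
  ... | yes _ = ⊥-elim (<-irrefl refl (<-≤-trans j< i≤j))
  ... | no no-walk with i ≟ j
  ...   | yes refl = no-walk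
  ...   | no i≢j = search-least m (suc i) v j (≤∧≢⇒< i≤j i≢j) j<

  -- depth v = min (dist (u, v), K).
  depth : V G → ℕ
  depth v = search K 0 v

  depth≤K : ∀ v → depth v ≤ K
  depth≤K v = search-≤ K 0 v

  depth-least : ∀ {v k} → Walk G u v k → depth v ≤ k
  depth-least {v} {k} w with depth v ≤? k
  ... | yes d≤k = d≤k
  ... | no d≰k = ⊥-elim (search-least K 0 v k z≤n (≰⇒> d≰k) w)

  depth-walk : ∀ v → depth v < K → Walk G u v (depth v)
  depth-walk v d<K with search-found K 0 v
  ... | inj₁ w = w
  ... | inj₂ d≡K = ⊥-elim (<-irrefl d≡K d<K)

  depth-cap : ∀ v → ¬ depth v < K → depth v ≡ K
  depth-cap v d≮K = ≤-antisym (depth≤K v) (≮⇒≥ d≮K)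

  depth-root : depth u ≡ 0
  depth-root = n≤0⇒n≡0 (depth-least [])

  depth-zero : ∀ {v} → depth v ≡ 0 → 0 < K → v ≡ u
  depth-zero {v} d≡0 0<K = at-root (subst (Walk G u v) d≡0 (depth-walk v (subst (_< K) (sym d≡0) 0<K)))
    where
    at-root : Walk G u v 0 → v ≡ u
    at-root [] = refl

  depth-adj : ∀ {v w} → Adj G v w → depth w ≤ suc (depth v)
  depth-adj {v} {w} vw with depth v <? K
  ... | yes d<K = depth-least (snoc (depth-walk v d<K) vw)
  ... | no d≮K = ≤-trans (depth≤K w) (≤-trans (≤-reflexive (sym (depth-cap v d≮K))) (n≤1+n (depth v)))

  depth-step : ∀ {v w} → Step G v w → depth v ≤ suc (depth w)
  depth-step (inj₁ refl) = n≤1+n _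
  depth-step (inj₂ vw) = depth-adj (adj-sym G vw)

  depth-ball : ∀ {i v} → Ball G u i v → depth v ≤ i
  depth-ball (k , k≤i , w) = ≤-trans (depth-least w) k≤i

  ball-depth : ∀ {i v} → depth v ≤ i → i < K → Ball G u i v
  ball-depth {i} {v} d≤i i<K = depth v , d≤i , depth-walk v (≤-<-trans d≤i i<K)

  lower-neighbour : ∀ v → 0 < depth v → depth v < K → Σ (V G) λ w → Adj G w v × suc (depth w) ≡ depth v
  lower-neighbour v 0<d d<K = from-walk (depth v) refl 0<d
    where
    from-walk : ∀ d → depth v ≡ d → 0 < d → Σ (V G) λ w → Adj G w v × suc (depth w) ≡ depth v
    from-walk (suc m) d≡ _ with unsnoc (subst (Walk G u v) d≡ (depth-walk v d<K))
    ... | w , p , wv = w , wv , ≤-antisym (≤-trans (s≤s (depth-least p)) (≤-reflexive (sym d≡))) (depth-adj wv)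

  -- The parent of v in the breadth-first tree: a chosen lower neighbour (v itself at the root).
  parent : V G → V G
  parent v with any? (λ w → adj-dec G w v ×-dec (suc (depth w) ≟ depth v))
  ... | yes (w , _) = w
  ... | no _ = v

  parent-spec : ∀ v → 0 < depth v → depth v < K → Adj G (parent v) v × suc (depth (parent v)) ≡ depth v
  parent-spec v 0<d d<K with any? (λ w → adj-dec G w v ×-dec (suc (depth w) ≟ depth v))
  ... | yes (_ , spec) = spec
  ... | no none = ⊥-elim (none (lower-neighbour v 0<d d<K))

  climb : ℕ → V G → V G
  climb zero v = v
  climb (suc n) v = climb n (parent v)

  climb-parent : ∀ n v → climb n (parent v) ≡ parent (climb n v)
  climb-parent zero v = refl
  climb-parent (suc n) v = climb-parent n (parent v)

  climb-depth : ∀ n v → n ≤ depth v → depth v < K → depth (climb n v) ≡ depth v ∸ n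
  climb-depth zero v _ _ = refl
  climb-depth (suc n) v n<d d<K =
    trans (climb-depth n (parent v) (s≤s⁻¹ (≤-trans n<d (≤-reflexive (sym pd))))
                                     (<-trans (≤-reflexive pd) d<K))
          (cong (_∸ suc n) pd)
    where
    pd : suc (depth (parent v)) ≡ depth v
    pd = proj₂ (parent-spec v (≤-trans (s≤s z≤n) n<d) d<K)

  -- anc i v: the ancestor of v at depth i (meaningful for i ≤ depth v < K; always u for i = 0).
  anc : ℕ → V G → V G
  anc zero v = u
  anc (suc i) v = climb (depth v ∸ suc i) v

  anc-depth : ∀ i v → i ≤ depth v → depth v < K → depth (anc i v) ≡ i
  anc-depth zero v _ _ = depth-root
  anc-depth (suc i) v i≤d d<K = trans (climb-depth (depth v ∸ suc i) v (m∸n≤m (depth v) (suc i)) d<K) (m∸[m∸n]≡n i≤d)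

  anc-below : ∀ i v → i ≤ depth v → depth v < K → depth (anc i v) < K
  anc-below i v i≤d d<K = ≤-<-trans (≤-trans (≤-reflexive (anc-depth i v i≤d d<K)) i≤d) d<K

  anc-self : ∀ d v → depth v ≡ d → depth v < K → anc d v ≡ v
  anc-self zero v d≡0 d<K = sym (depth-zero d≡0 (≤-trans (s≤s z≤n) d<K))
  anc-self (suc d) v d≡ _ = cong (λ k → climb k v) (trans (cong (_∸ suc d) d≡) (n∸n≡0 (suc d)))

  anc-step : ∀ i v → suc i ≤ depth v → depth v < K → anc i v ≡ parent (anc (suc i) v)
  anc-step zero v 1≤d d<K =
    sym (depth-zero (suc-injective (trans pd (anc-depth 1 v 1≤d d<K))) (≤-trans (s≤s z≤n) d<K))
    where
    pd : suc (depth (parent (anc 1 v))) ≡ depth (anc 1 v)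
    pd = proj₂ (parent-spec (anc 1 v) (≤-reflexive (sym (anc-depth 1 v 1≤d d<K))) (anc-below 1 v 1≤d d<K))
  anc-step (suc i) v i<d _ =
    trans (cong (λ k → climb k v) (∸-suc i<d)) (climb-parent (depth v ∸ suc (suc i)) v)

  anc-adj : ∀ i v → suc i ≤ depth v → depth v < K → Adj G (anc i v) (anc (suc i) v)
  anc-adj i v i<d d<K =
    subst (λ w → Adj G w (anc (suc i) v)) (sym (anc-step i v i<d d<K))
      (proj₁ (parent-spec (anc (suc i) v) (≤-trans (s≤s z≤n) (≤-reflexive (sym (anc-depth (suc i) v i<d d<K))))
                                          (anc-below (suc i) v i<d d<K)))

  anc-inherit : ∀ i v v' → v ≡ parent v' → depth v' ≡ suc (depth v) → i ≤ depth v → anc i v' ≡ anc i v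
  anc-inherit zero v v' _ _ _ = refl
  anc-inherit (suc i) v v' v≡pv' d≡ i<d =
    trans (cong (λ k → climb k v') (trans (cong (_∸ suc i) d≡) (∸-suc i<d)))
          (cong (climb (depth v ∸ suc i)) (sym v≡pv'))

module Tree (G : Graph) (u : V G) (K : ℕ) (noShortCycle : ∀ L → Cycle G L → K + K ≤ suc L) where
  open Depth G u K public

  line : ℕ → V G → ℕ → V G
  line j v i = anc (j + i) v

  line-adj : ∀ j v i → i < depth v ∸ j → j ≤ depth v → depth v < K →
    Adj G (line j v i) (line j v (suc i))
  line-adj j v i i< j≤d d<K =
    subst (λ k → Adj G (anc (j + i) v) (anc k v)) (sym (+-suc j i))
      (anc-adj (j + i) v (≤-trans (+-monoʳ-< j i<) (≤-reflexive (m+[n∸m]≡n j≤d))) d<K)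

  line-depth : ∀ j v i → i ≤ depth v ∸ j → j ≤ depth v → depth v < K → depth (line j v i) ≡ j + i
  line-depth j v i i≤ j≤d d<K =
    anc-depth (j + i) v (≤-trans (+-monoʳ-≤ j i≤) (≤-reflexive (m+[n∸m]≡n j≤d))) d<K

  line-top : ∀ j v → j ≤ depth v → depth v < K → line j v (depth v ∸ j) ≡ v
  line-top j v j≤d d<K = anc-self (j + (depth v ∸ j)) v (sym (m+[n∸m]≡n j≤d)) d<K

  -- Adjacent x, y with depth y ≤ depth x < K whose ancestor lines have separated by depth
  -- (depth y) close a cycle through their last common ancestor, of length ≤ depth x + depth y + 1.
  split-cycle : ∀ {x y} → Adj G x y → depth y ≤ depth x → depth x < K → anc (depth y) x ≢ y →
    Σ ℕ λ L → L ≤ suc (depth x + depth y) × Cycle G L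
  split-cycle {x} {y} xy dy≤dx dx<K separated
    with lastAgreement _≟ᶠ_ (λ i → anc i x) (λ i → anc i y) (depth y) refl
           (λ same → separated (trans same (anc-self (depth y) y refl (≤-<-trans dy≤dx dx<K))))
  ... | j , j<dy , meet , apart =
    suc (e + e') , s≤s (+-mono-≤ (m∸n≤m (depth x) j) (m∸n≤m (depth y) j)) ,
    twoBranch-cycle G depth (line j x) (line j y) j e e'
      (m<n⇒0<n∸m (<-≤-trans j<dy dy≤dx)) (m<n⇒0<n∸m j<dy)
      (subst (λ k → anc k x ≡ anc k y) (sym (+-identityʳ j)) meet)
      (λ i i< → line-adj j x i i< j≤dx dx<K)
      (λ i i< → line-adj j y i i< j≤dy dy<K)
      (subst₂ (Adj G) (sym (line-top j x j≤dx dx<K)) (sym (line-top j y j≤dy dy<K)) xy)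
      (λ i i≤ → line-depth j x i i≤ j≤dx dx<K)
      (λ i i≤ → line-depth j y i i≤ j≤dy dy<K)
      (λ i 1≤i i≤ → apart (j + i) (m<m+n j 1≤i) (≤-trans (+-monoʳ-≤ j i≤) (≤-reflexive (m+[n∸m]≡n j≤dy))))
    where
    e e' : ℕ
    e = depth x ∸ j
    e' = depth y ∸ j
    dy<K : depth y < K
    dy<K = ≤-<-trans dy≤dx dx<K
    j≤dy : j ≤ depth y
    j≤dy = <⇒≤ j<dy
    j≤dx : j ≤ depth x
    j≤dx = ≤-trans j≤dy dy≤dx

  split-absurd : ∀ {x y} → Adj G x y → depth y ≤ depth x → depth x < K → suc (suc (depth y)) ≤ K →
    anc (depth y) x ≢ y → ⊥
  split-absurd {x} {y} xy dy≤dx dx<K dy+2≤K separated with split-cycle xy dy≤dx dx<K separated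
  ... | L , L≤ , cycle =
    <-irrefl refl (≤-trans (≤-trans (≤-reflexive (three-more (depth x) (depth y))) (+-mono-≤ dx<K dy+2≤K))
                           (≤-trans (noShortCycle L cycle) (s≤s L≤)))

  parent-unique : ∀ w v → Adj G w v → suc (depth w) ≡ depth v → depth v < K → w ≡ parent v
  parent-unique w v wv d≡ dv<K with w ≟ᶠ parent v
  ... | yes w≡pv = w≡pv
  ... | no w≢pv = ⊥-elim (split-absurd (adj-sym G wv) (≤-trans (n≤1+n _) (≤-reflexive d≡)) dv<K
                           (≤-trans (s≤s (≤-reflexive d≡)) dv<K) separated)
    where
    separated : anc (depth w) v ≢ w
    separated anc≡w = w≢pv (trans (sym anc≡w)
      (trans (anc-step (depth w) v (≤-reflexive d≡) dv<K) (cong parent (anc-self (suc (depth w)) v (sym d≡) dv<K))))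

  level-edge-absurd : ∀ {x y} → Adj G x y → depth x ≡ depth y → suc (suc (depth x)) ≤ K → ⊥
  level-edge-absurd {x} {y} xy d≡ dx+2≤K =
    split-absurd xy (≤-reflexive (sym d≡)) (≤-trans (n≤1+n _) dx+2≤K) (subst (λ d → suc (suc d) ≤ K) d≡ dx+2≤K)
      (λ anc≡y → adj-irr G (subst (Adj G x) (trans (sym anc≡y) (anc-self (depth y) x d≡ dx<K)) xy))
    where
    dx<K : depth x < K
    dx<K = ≤-trans (n≤1+n _) dx+2≤K

Near : ℕ → ℕ → Set
Near a b = b ≡ a ⊎ b ≡ suc a ⊎ a ≡ suc b

near-pred : ∀ {a b} → Near a b → Near (a ∸ 1) (b ∸ 1)
near-pred (inj₁ refl) = inj₁ refl
near-pred {zero} (inj₂ (inj₁ refl)) = inj₁ refl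
near-pred {suc a} (inj₂ (inj₁ refl)) = inj₂ (inj₁ refl)
near-pred {b = zero} (inj₂ (inj₂ refl)) = inj₁ refl
near-pred {b = suc b} (inj₂ (inj₂ refl)) = inj₂ (inj₂ refl)

-- fold ρ d: the depth of the shadow of a robber at depth d ≤ 2ρ.  It follows the robber up
-- to depth ρ and then, as the robber moves out to depth 2ρ, runs back down to the root.
fold : ℕ → ℕ → ℕ
fold ρ d with d ≤? ρ
... | yes _ = d
... | no _ = (ρ + ρ) ∸ d

fold-≤ : ∀ ρ d → fold ρ d ≤ d
fold-≤ ρ d with d ≤? ρ
... | yes _ = ≤-refl
... | no d≰ρ = ≤-trans (∸-monoʳ-≤ (ρ + ρ) (<⇒≤ (≰⇒> d≰ρ)))
                       (≤-trans (≤-reflexive (m+n∸m≡n ρ ρ)) (<⇒≤ (≰⇒> d≰ρ)))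

fold-middle : ∀ ρ → fold ρ ρ ≡ ρ
fold-middle ρ with ρ ≤? ρ
... | yes _ = refl
... | no ρ≰ρ = ⊥-elim (ρ≰ρ ≤-refl)

fold-end : ∀ ρ → 1 ≤ ρ → fold ρ (ρ + ρ) ≡ 0
fold-end ρ 1≤ρ with (ρ + ρ) ≤? ρ
... | yes 2ρ≤ρ = ⊥-elim (<-irrefl refl (<-≤-trans (m<m+n ρ 1≤ρ) 2ρ≤ρ))
... | no _ = n∸n≡0 (ρ + ρ)

fold-rim : ∀ ρ → 1 ≤ ρ → fold ρ ((ρ + ρ) ∸ 1) ≡ 1
fold-rim (suc zero) _ = refl
fold-rim (suc (suc r)) _ with (suc (suc r) + suc (suc r)) ∸ 1 ≤? suc (suc r)
... | yes rim≤ρ = ⊥-elim (<-irrefl refl (<-≤-trans (m<n+m (suc (suc r)) (s≤s z≤n)) rim≤ρ))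
... | no _ = m+n∸n≡m 1 (suc r + suc (suc r))

near-fold : ∀ ρ d → suc d ≤ ρ + ρ → Near (fold ρ d) (fold ρ (suc d))
near-fold ρ d d<2ρ with d ≤? ρ | suc d ≤? ρ
... | yes _ | yes _ = inj₂ (inj₁ refl)
... | yes d≤ρ | no d≮ρ = inj₂ (inj₂ (begin
  d                        ≡⟨ d≡ρ ⟩
  ρ                        ≡⟨ sym (m+n∸m≡n ρ ρ) ⟩
  (ρ + ρ) ∸ ρ              ≡⟨ cong ((ρ + ρ) ∸_) (sym d≡ρ) ⟩
  (ρ + ρ) ∸ d              ≡⟨ ∸-suc d<2ρ ⟩
  suc ((ρ + ρ) ∸ suc d)    ∎))
  where
  open ≡-Reasoning
  d≡ρ : d ≡ ρ
  d≡ρ = ≤-antisym d≤ρ (s≤s⁻¹ (≰⇒> d≮ρ))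
... | no d≰ρ | yes d<ρ = ⊥-elim (d≰ρ (<⇒≤ d<ρ))
... | no _ | no _ = inj₂ (inj₂ (∸-suc d<2ρ))

CanCover : (G : Graph) → V G × V G → V G → V G → Set
CanCover G p s t = (Step G (proj₁ p) s × Step G (proj₂ p) t) ⊎ (Step G (proj₁ p) t × Step G (proj₂ p) s)

Follows : (G : Graph) (S T : V G → V G) → V G → V G → Set
Follows G S T v v' = CanCover G (S v , T v) (S v') (T v')

module Shadow (G : Graph) (u : V G) (ρ : ℕ) (1≤ρ : 1 ≤ ρ)
  (noShortCycle : ∀ L → Cycle G L → (ρ + ρ) + (ρ + ρ) ≤ suc L) where
  open Tree G u (ρ + ρ) noShortCycle public

  K : ℕ
  K = ρ + ρ

  ρ<K : ρ < K
  ρ<K = m<m+n ρ 1≤ρ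

  rim≡ : K ∸ 1 ≡ suc (K ∸ 2)
  rim≡ = ∸-suc (+-mono-≤ 1≤ρ 1≤ρ)

  rim<K : K ∸ 1 < K
  rim<K = ≤-reflexive (sym (+-∸-assoc 1 (≤-trans 1≤ρ (m≤m+n ρ ρ))))

  ρ≤rim : ρ ≤ K ∸ 1
  ρ≤rim = ≤-trans (m≤m+n ρ (ρ ∸ 1)) (≤-reflexive (sym (+-∸-assoc ρ 1≤ρ)))

  ancestor-step : ∀ i j v → i ≤ depth v → j ≤ depth v → depth v < K → Near i j → Step G (anc i v) (anc j v)
  ancestor-step i j v i≤d j≤d d<K (inj₁ refl) = inj₁ refl
  ancestor-step i j v i≤d j≤d d<K (inj₂ (inj₁ refl)) = inj₂ (anc-adj i v j≤d d<K)
  ancestor-step i j v i≤d j≤d d<K (inj₂ (inj₂ refl)) = inj₂ (adj-sym G (anc-adj j v i≤d d<K))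

  S T : V G → V G
  S v = anc (fold ρ (depth v)) v
  T v = anc (fold ρ (depth v) ∸ 1) v

  shadow-cap : ∀ v → depth v ≡ K → S v ≡ u × T v ≡ u
  shadow-cap v d≡K = cong (λ i → anc i v) fold≡0 , cong (λ i → anc (i ∸ 1) v) fold≡0
    where
    fold≡0 : fold ρ (depth v) ≡ 0
    fold≡0 = trans (cong (fold ρ) d≡K) (fold-end ρ 1≤ρ)

  shadow-rim : ∀ v → depth v ≡ K ∸ 1 → Adj G u (S v) × T v ≡ u
  shadow-rim v d≡ =
    subst (Adj G u) (sym (cong (λ i → anc i v) fold≡1))
      (anc-adj 0 v (≤-trans (≤-trans 1≤ρ ρ≤rim) (≤-reflexive (sym d≡))) (≤-<-trans (≤-reflexive d≡) rim<K)) ,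
    cong (λ i → anc (i ∸ 1) v) fold≡1
    where
    fold≡1 : fold ρ (depth v) ≡ 1
    fold≡1 = trans (cong (fold ρ) d≡) (fold-rim ρ 1≤ρ)

  shadow-meets : ∀ v → depth v ≡ ρ → S v ≡ v
  shadow-meets v d≡ρ = trans (cong (λ i → anc i v) (trans (cong (fold ρ) d≡ρ) (fold-middle ρ)))
                             (anc-self ρ v d≡ρ (≤-<-trans (≤-reflexive d≡ρ) ρ<K))

  follow-up : ∀ v v' → Adj G v v' → depth v' ≡ suc (depth v) → Step G (S v) (S v') × Step G (T v) (T v')
  follow-up v v' vv' d≡ with depth v' <? K
  ... | yes d'<K =
    along (fold-≤ ρ (depth v)) (fold-≤ ρ (depth v')) near ,
    along (≤-trans (m∸n≤m _ 1) (fold-≤ ρ (depth v))) (≤-trans (m∸n≤m _ 1) (fold-≤ ρ (depth v'))) (near-pred near)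
    where
    near : Near (fold ρ (depth v)) (fold ρ (depth v'))
    near = subst (λ d → Near (fold ρ (depth v)) (fold ρ d)) (sym d≡)
             (near-fold ρ (depth v) (≤-trans (≤-reflexive (sym d≡)) (<⇒≤ d'<K)))
    -- v is the parent of v', so the ancestors of v are ancestors of v'.
    along : ∀ {i j} → i ≤ depth v → j ≤ depth v' → Near i j → Step G (anc i v) (anc j v')
    along {i} {j} i≤d j≤d' i~j =
      subst (λ w → Step G w (anc j v')) (anc-inherit i v v' (parent-unique v v' vv' (sym d≡) d'<K) d≡ i≤d)
        (ancestor-step i j v' (≤-trans i≤d (≤-trans (n≤1+n _) (≤-reflexive (sym d≡)))) j≤d' d'<K i~j)
  ... | no d'≮K =
    subst (Step G (S v)) (sym (proj₁ cap)) (inj₂ (adj-sym G (proj₁ rim))) ,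
    subst₂ (Step G) (sym (proj₂ rim)) (sym (proj₂ cap)) (inj₁ refl)
    where
    cap : S v' ≡ u × T v' ≡ u
    cap = shadow-cap v' (depth-cap v' d'≮K)
    rim : Adj G u (S v) × T v ≡ u
    rim = shadow-rim v (cong (_∸ 1) (trans (sym d≡) (depth-cap v' d'≮K)))

  -- A robber step within one level: impossible below K − 1, crossed at K − 1, trivial at K.
  follow-level : ∀ v v' → Adj G v v' → depth v ≡ depth v' → Follows G S T v v'
  follow-level v v' vv' d≡ with depth v <? K
  ... | no d≮K = inj₁ (subst₂ (Step G) (sym (proj₁ cap)) (sym (proj₁ cap')) (inj₁ refl) ,
                       subst₂ (Step G) (sym (proj₂ cap)) (sym (proj₂ cap')) (inj₁ refl))
    where
    cap : S v ≡ u × T v ≡ u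
    cap = shadow-cap v (depth-cap v d≮K)
    cap' : S v' ≡ u × T v' ≡ u
    cap' = shadow-cap v' (trans (sym d≡) (depth-cap v d≮K))
  ... | yes d<K with suc (suc (depth v)) ≤? K
  ...   | yes below-rim = ⊥-elim (level-edge-absurd vv' d≡ below-rim)
  ...   | no at-rim = inj₂ (subst (Step G (S v)) (sym (proj₂ rim')) (inj₂ (adj-sym G (proj₁ rim))) ,
                            subst (λ w → Step G w (S v')) (sym (proj₂ rim)) (inj₂ (proj₁ rim')))
    where
    d≡rim : depth v ≡ K ∸ 1
    d≡rim = cong (_∸ 1) (≤-antisym d<K (s≤s⁻¹ (≰⇒> at-rim)))
    rim : Adj G u (S v) × T v ≡ u
    rim = shadow-rim v d≡rim
    rim' : Adj G u (S v') × T v' ≡ u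
    rim' = shadow-rim v' (trans (sym d≡) d≡rim)

  follow : ∀ v v' → Step G v v' → Follows G S T v v'
  follow v v' (inj₁ refl) = inj₁ (inj₁ refl , inj₁ refl)
  follow v v' (inj₂ vv') with <-cmp (depth v) (depth v')
  ... | tri< d<d' _ _ = inj₁ (follow-up v v' vv' (≤-antisym (depth-adj vv') d<d'))
  ... | tri≈ _ d≡d' _ = follow-level v v' vv' d≡d'
  ... | tri> _ _ d>d' with follow-up v' v (adj-sym G vv') (≤-antisym (depth-adj (adj-sym G vv')) d>d')
  ...   | back-S , back-T = inj₁ (Step-sym {G} back-S , Step-sym {G} back-T)

  far-depth : ∀ v → ¬ Ball G u (K ∸ 2) v → depth v ≡ K ∸ 1 ⊎ depth v ≡ K
  far-depth v far with depth v <? K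
  ... | no d≮K = inj₂ (depth-cap v d≮K)
  ... | yes d<K = inj₁ (≤-antisym (∸-monoˡ-≤ 1 d<K) rim≤d)
    where
    rim≤d : K ∸ 1 ≤ depth v
    rim≤d with depth v ≤? K ∸ 2
    ... | yes inside = ⊥-elim (far (ball-depth inside (≤-trans (≤-reflexive (sym rim≡)) (<⇒≤ rim<K))))
    ... | no beyond = ≤-trans (≤-reflexive rim≡) (≰⇒> beyond)

  start-cover : ∀ v → ¬ Ball G u (K ∸ 2) v → CanCover G (u , u) (S v) (T v)
  start-cover v far with far-depth v far
  ... | inj₁ d≡rim = inj₁ (inj₂ (proj₁ (shadow-rim v d≡rim)) , inj₁ (sym (proj₂ (shadow-rim v d≡rim))))
  ... | inj₂ d≡K = inj₁ (inj₁ (sym (proj₁ (shadow-cap v d≡K))) , inj₁ (sym (proj₂ (shadow-cap v d≡K))))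

  start-depth : ∀ v → ¬ Ball G u (K ∸ 2) v → ρ ≤ depth v
  start-depth v far with far-depth v far
  ... | inj₁ d≡rim = ≤-trans ρ≤rim (≤-reflexive (sym d≡rim))
  ... | inj₂ d≡K = ≤-trans (<⇒≤ ρ<K) (≤-reflexive (sym d≡K))

-- The shadow strategy for two cops starting at u: after the cops' move of round t they stand on
-- {S (r t), T (r t)}, as long as the robber's moves can be followed (Follows) and the first
-- shadow is within reach of u.
module ShadowStrategy (G : Graph) (u : V G) (S T : V G → V G)
  (follow : ∀ v v' → Step G v v' → Follows G S T v v') where

  OnShadow : V G × V G → V G → Set
  OnShadow p v = p ≡ (S v , T v) ⊎ p ≡ (T v , S v)

  Moves : V G × V G → V G × V G → Set
  Moves p q = Step G (proj₁ p) (proj₁ q) × Step G (proj₂ p) (proj₂ q)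

  on-cover : ∀ {p v v'} → OnShadow p v → Step G v v' → CanCover G p (S v') (T v')
  on-cover (inj₁ refl) vv' = follow _ _ vv'
  on-cover {v = v} {v'} (inj₂ refl) vv' with follow v v' vv'
  ... | inj₁ (s , t) = inj₂ (t , s)
  ... | inj₂ (s , t) = inj₁ (t , s)

  retarget : V G × V G → V G → V G × V G
  retarget p v with Step? G (proj₁ p) (S v) ×-dec Step? G (proj₂ p) (T v)
  ... | yes _ = S v , T v
  ... | no _ = T v , S v

  retarget-on : ∀ p v → OnShadow (retarget p v) v
  retarget-on p v with Step? G (proj₁ p) (S v) ×-dec Step? G (proj₂ p) (T v)
  ... | yes _ = inj₁ refl
  ... | no _ = inj₂ refl

  retarget-moves : ∀ p v → CanCover G p (S v) (T v) → Moves p (retarget p v)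
  retarget-moves p v cover with Step? G (proj₁ p) (S v) ×-dec Step? G (proj₂ p) (T v)
  ... | yes straight = straight
  ... | no not-straight with cover
  ...   | inj₁ straight = ⊥-elim (not-straight straight)
  ...   | inj₂ crossed = crossed

  -- Cop positions after the cops' move of round t against the robber positions r.
  play : (ℕ → V G) → ℕ → V G × V G
  play r zero = retarget (u , u) (r 0)
  play r (suc t) = retarget (play r t) (r (suc t))

  play-on : ∀ r t → OnShadow (play r t) (r t)
  play-on r zero = retarget-on _ _
  play-on r (suc t) = retarget-on _ _

  play-local : ∀ r r' t → (∀ k → k ≤ t → r k ≡ r' k) → play r t ≡ play r' t
  play-local r r' zero agree = cong (retarget (u , u)) (agree 0 z≤n)
  play-local r r' (suc t) agree =
    cong₂ retarget (play-local r r' t (λ k k≤t → agree k (m≤n⇒m≤1+n k≤t))) (agree (suc t) ≤-refl)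

  extend : (t : ℕ) → (Fin (suc t) → V G) → ℕ → V G
  extend t history k with k <? suc t
  ... | yes k≤t = history (fromℕ< k≤t)
  ... | no _ = history (fromℕ t)

  extend-agrees : ∀ (r : ℕ → V G) t k → k ≤ t → extend t (λ i → r (toℕ i)) k ≡ r k
  extend-agrees r t k k≤t with k <? suc t
  ... | yes k<st = cong r (toℕ-fromℕ< k<st)
  ... | no k≮st = ⊥-elim (k≮st (s≤s k≤t))

  σ : CopStrategy G
  σ t history = play (extend t history) t

  -- The positions produced by σ depend only on the history, hence coincide with play.
  copPos-play : ∀ r t → copPos G u σ r (suc t) ≡ play r t
  copPos-play r t = play-local _ r t (extend-agrees r t)

  legal : ∀ r → CanCover G (u , u) (S (r 0)) (T (r 0)) → (∀ t → Step G (r t) (r (suc t))) →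
    ∀ t → Moves (copPos G u σ r t) (copPos G u σ r (suc t))
  legal r start moves zero =
    subst (Moves (u , u)) (sym (copPos-play r 0)) (retarget-moves (u , u) (r 0) start)
  legal r start moves (suc t) =
    subst₂ Moves (sym (copPos-play r t)) (sym (copPos-play r (suc t)))
      (retarget-moves (play r t) (r (suc t)) (on-cover (play-on r t) (moves t)))

  catches : ∀ r s → S (r s) ≡ r s → CopAt G (copPos G u σ r (suc s)) (r s)
  catches r s meets with subst (λ p → OnShadow p (r s)) (sym (copPos-play r s)) (play-on r s)
  ... | inj₁ p≡ = inj₁ (trans (cong proj₁ p≡) meets)
  ... | inj₂ p≡ = inj₂ (trans (cong proj₂ p≡) meets)

module Defence (G : Graph) (u : V G) (ρ : ℕ) (1≤ρ : 1 ≤ ρ)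
  (noShortCycle : ∀ L → Cycle G L → (ρ + ρ) + (ρ + ρ) ≤ suc L) where
  open Shadow G u ρ 1≤ρ noShortCycle public
  open ShadowStrategy G u S T follow public

  guards : ∀ r → ρ ≤ depth (r 0) → (∀ t → Step G (r t) (r (suc t))) →
    ∀ t → CapturedBy G u σ r t ⊎ ¬ Ball G u ρ (r t)
  guards r start moves t with depth (r t) ≤? ρ
  ... | no outside = inj₂ (λ inside → outside (depth-ball inside))
  ... | yes inside with hitsLevel (λ k → depth (r k)) ρ (λ k → depth-step (moves k)) start t inside
  ...   | s , s≤t , at-ρ = inj₁ (s , s≤t , inj₂ (catches r s (shadow-meets (r s) at-ρ)))

radius-positive : ∀ {G g} → Girth G g → 1 ≤ (g + 1) / 4
radius-positive {g = g} (shortest , _) = m≥n⇒m/n>0 {g + 1} {4} (+-monoˡ-≤ 1 (Cycle.three shortest))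

four-copies : ∀ x → (x + x) + (x + x) ≡ x * 4
four-copies = solve-∀

radius-cycles : ∀ {G g} → Girth G g → ∀ L → Cycle G L →
  ((g + 1) / 4 + (g + 1) / 4) + ((g + 1) / 4 + (g + 1) / 4) ≤ suc L
radius-cycles {g = g} (_ , minimal) L cycle = begin
  (ρ + ρ) + (ρ + ρ)  ≡⟨ four-copies ρ ⟩
  ρ * 4              ≤⟨ m/n*n≤m (g + 1) 4 ⟩
  g + 1              ≡⟨ +-comm g 1 ⟩
  suc g              ≤⟨ s≤s (minimal L cycle) ⟩
  suc L              ∎
  where
  open ≤-Reasoning
  ρ : ℕ
  ρ = (g + 1) / 4

lemma9 : (G : Graph) (g : ℕ) → Girth G g →
    (u r₀ : V G) → ¬ Ball G u (2 * ((g + 1) / 4) ∸ 2) r₀ →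
    Σ (CopStrategy G) λ σ →
      (r : ℕ → V G) → r 0 ≡ r₀ → (∀ t → Step G (r t) (r (suc t))) →
      (t : ℕ) →
        (Step G (proj₁ (copPos G u σ r t)) (proj₁ (copPos G u σ r (suc t)))
         × Step G (proj₂ (copPos G u σ r t)) (proj₂ (copPos G u σ r (suc t))))
        × (CapturedBy G u σ r t ⊎ ¬ Ball G u ((g + 1) / 4) (r t))
lemma9 G g girth u r₀ far = σ , λ r r0 moves t →
  legal r (subst (λ v → CanCover G (u , u) (S v) (T v)) (sym r0) (start-cover r₀ far₂ρ)) moves t ,
  guards r (subst (λ v → ρ ≤ depth v) (sym r0) (start-depth r₀ far₂ρ)) moves t
  where
  ρ : ℕ
  ρ = (g + 1) / 4
  open Defence G u ρ (radius-positive girth) (radius-cycles girth)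
  far₂ρ : ¬ Ball G u ((ρ + ρ) ∸ 2) r₀
  far₂ρ = subst (λ k → ¬ Ball G u (k ∸ 2) r₀) (cong (ρ +_) (+-identityʳ ρ)) far
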